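{- The class of proper max-point-tolerance graphs and the class of proper max-tolerance graphs are incomparable: there is a proper max-tolerance graph that is not a proper max-point-tolerance graph, and there is a proper max-point-tolerance graph that is not a proper max-tolerance graph.
   Context: All graphs are finite, simple, undirected. $G=(V,E)$ is a max-point-tolerance graph (MPTG) if each vertex $u$ can be assigned a pair $(I_u,p_u)$, with $I_u$ a closed bounded real interval and $p_u\in I_u$, such that for distinct $u,v$, $uv\in E$ iff $\{p_u,p_v\}\subseteq I_u\cap I_v$; it is a proper MPTG if such a representation exists in which no interval properly contains another. $G$ is a max-tolerance graph if each vertex $u$ can be assigned a closed bounded real interval $I_u$ and a positive real $t_u$ such that for distinct $u,v$, $uv\in E$ iff $|I_u\cap I_v|\ge\max\{t_u,t_v\}$ ($|\cdot|$ = length); it is a proper max-tolerance graph if such a representation exists in which no interval properly contains another.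
   Formalization: The interval endpoints, the points $p_u$ and the tolerances $t_u$ are taken in ℚ rather than in the reals. -}

module Defs where

open import Data.Nat using (ℕ)
open import Data.Fin using (Fin)
open import Data.Bool using (Bool; true; false)
open import Data.Rational using (ℚ; 0ℚ; _≤_; _<_; _-_; _⊔_; _⊓_)
open import Data.Product using (_×_; Σ; ∃)
open import Relation.Binary.PropositionalEquality using (_≡_; _≢_)
open import Relation.Nullary using (¬_)
open import Function.Bundles using (_⇔_)

record Graph : Set where
  field
    n     : ℕ
    adj   : Fin n → Fin n → Bool
    sym   : ∀ u v → adj u v ≡ adj v u
    irref : ∀ u → adj u u ≡ false
  Edge : Fin n → Fin n → Set
  Edge u v = adj u v ≡ true

record Interval : Set where
  constructor [_,_]⟨_⟩
  field
    lo  : ℚ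
    hi  : ℚ
    ok  : lo ≤ hi
open Interval public

_∈I_ : ℚ → Interval → Set
x ∈I I = lo I ≤ x × x ≤ hi I

_⊆I_ : Interval → Interval → Set
I ⊆I J = lo J ≤ lo I × hi I ≤ hi J

_⊂I_ : Interval → Interval → Set
I ⊂I J = I ⊆I J × ¬ (lo I ≡ lo J × hi I ≡ hi J)

∣_∩_∣ : Interval → Interval → ℚ
∣ I ∩ J ∣ = 0ℚ ⊔ ((hi I ⊓ hi J) - (lo I ⊔ lo J))

Proper : ∀ {n} → (Fin n → Interval) → Set
Proper {n} I = ∀ (u v : Fin n) → ¬ (I v ⊂I I u)

IsMPTGRep : (G : Graph) → (Fin (Graph.n G) → Interval) → (Fin (Graph.n G) → ℚ) → Set
IsMPTGRep G I p =
  (∀ u → p u ∈I I u) ×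
  (∀ u v → u ≢ v →
     (Graph.Edge G u v ⇔ ((p u ∈I I u × p u ∈I I v) × (p v ∈I I u × p v ∈I I v))))

IsProperMPTG : Graph → Set
IsProperMPTG G = Σ (Fin (Graph.n G) → Interval) λ I → Σ (Fin (Graph.n G) → ℚ) λ p →
  IsMPTGRep G I p × Proper I

IsMaxTolRep : (G : Graph) → (Fin (Graph.n G) → Interval) → (Fin (Graph.n G) → ℚ) → Set
IsMaxTolRep G I t =
  (∀ u → 0ℚ < t u) ×
  (∀ u v → u ≢ v → (Graph.Edge G u v ⇔ (t u ⊔ t v ≤ ∣ I u ∩ I v ∣)))

IsProperMaxTol : Graph → Set
IsProperMaxTol G = Σ (Fin (Graph.n G) → Interval) λ I → Σ (Fin (Graph.n G) → ℚ) λ t →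
  IsMaxTolRep G I t × Proper I

{-# OPTIONS --safe #-}

-- Order the vertices of a proper representation by left endpoints; as no interval
-- contains another, right endpoints follow the same order.
--
-- Proper MPTG: if u ≼ v ≼ w and I u meets I w, then I u ∩ I w ⊆ I v ⊆ I u ∪ I w, so an
-- edge uw makes v adjacent to u or to w (p v lies in I u or I w).  No linear order of C₅
-- has this property: assuming 0 ≼ 2 (the property is invariant under reversal), each
-- non-edge forces the next comparison until the order closes into a cycle.
--
-- Proper max-tolerance: for u ≼ v the overlap of I u and I v has length
-- max 0 (hi u − lo v), and hi u − lo v can only shrink when u moves left or v moves
-- right.  This forbids two ordered patterns on four vertices.  Given non-adjacent x ≼ y
-- with three pairwise non-adjacent common neighbours, two of these agree on whether they
-- lie between x and y, and each such pair completes one of the patterns; hence K₂,₃ is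
-- not a proper max-tolerance graph.
--
-- Explicit representations show that C₅ is a proper max-tolerance graph and K₂,₃ a
-- proper MPTG.
module Submission where

open import Defs
open import Data.Bool using (Bool; true; false; _∨_; _xor_)
import Data.Bool.Properties as Bool
open import Data.Empty using (⊥; ⊥-elim)
open import Data.Fin using (Fin; toℕ)
open import Data.Fin.Patterns using (0F; 1F; 2F; 3F; 4F)
import Data.Fin.Properties as Fin
open import Data.Integer using (+_)
open import Data.Nat using (ℕ; ∣_-_∣; _≡ᵇ_; _<ᵇ_)
open import Data.Product using (_×_; _,_; ∃; proj₁; proj₂; swap)
open import Data.Rational using (ℚ; 0ℚ; _/_; _≤_; _<_; _+_; _-_; _⊔_)
open import Data.Rational.Properties
open import Data.Rational.Solver using (module +-*-Solver)
open import Data.Sum using (_⊎_; inj₁; inj₂; [_,_]′)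
open import Function using (id; flip)
open import Function.Bundles using (_⇔_; mk⇔; module Equivalence)
open import Relation.Binary.Definitions using (Total)
open import Relation.Binary.PropositionalEquality
  using (_≡_; _≢_; refl; sym; trans; subst; cong₂; ≢-sym)
open import Relation.Nullary using (¬_; Dec; yes; no)
open import Relation.Nullary.Decidable using (True; toWitness; from-yes; map′; _×-dec_; _→-dec_; ¬?)

module _ (G : Graph) where
  open Graph G using (n; Edge)

  Apart : Fin n → Fin n → Set
  Apart u v = u ≢ v × ¬ Edge u v

  CommonNeighbour : Fin n → Fin n → Fin n → Set
  CommonNeighbour x y z = Edge x z × Edge y z

  Bridged : (Fin n → Fin n → Set) → Set
  Bridged _≼_ = ∀ {u v w} → u ≼ v → v ≼ w → Edge u w → ¬ Edge u v → ¬ Edge v w → ⊥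

  CrossingClosed : (Fin n → Fin n → Set) → Set
  CrossingClosed _≼_ = ∀ {a b c d} → a ≼ b → b ≼ c → c ≼ d →
    Edge a c → Edge b d → Apart b c → ⊥

  NoDoubleGap : (Fin n → Fin n → Set) → Set
  NoDoubleGap _≼_ = ∀ {a b c d} → a ≼ b → b ≼ c → c ≼ d →
    Apart a b → Apart c d → Edge a c → Edge a d → Edge b d → ⊥

module _ {G : Graph} where
  open Graph G using (Edge)

  Edge-sym : ∀ {u v} → Edge u v → Edge v u
  Edge-sym {u} {v} uv = trans (Graph.sym G v u) uv

  Edge⇒≢ : ∀ {u v} → Edge u v → u ≢ v
  Edge⇒≢ {u} uu refl with trans (sym (Graph.irref G u)) uu
  ... | ()

  Apart-sym : ∀ {u v} → Apart G u v → Apart G v u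
  Apart-sym (u≢v , ¬uv) = ≢-sym u≢v , (λ vu → ¬uv (Edge-sym vu))

  Bridged-flip : ∀ {_≼_} → Bridged G _≼_ → Bridged G (flip _≼_)
  Bridged-flip bridged v≽u w≽v uw ¬uv ¬vw =
    bridged w≽v v≽u (Edge-sym uw) (λ wv → ¬vw (Edge-sym wv)) (λ vu → ¬uv (Edge-sym vu))

overlapLength : Interval → Interval → ℚ
overlapLength I J = hi I - lo J

overlapLength-exchange : ∀ I J K L →
  overlapLength I J + overlapLength K L ≡ overlapLength K J + overlapLength I L
overlapLength-exchange I J K L = exchange (hi I) (lo J) (hi K) (lo L)
  where
  open +-*-Solver
  exchange : ∀ a b c d → (a - b) + (c - d) ≡ (c - b) + (a - d)
  exchange = solve 4 (λ a b c d → (a :- b) :+ (c :- d) := (c :- b) :+ (a :- d)) refl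

≤0⊔⇒≤ : ∀ {m d} → 0ℚ < m → m ≤ 0ℚ ⊔ d → m ≤ d
≤0⊔⇒≤ {m} {d} 0<m m≤0⊔d with ≤-total 0ℚ d
... | inj₁ 0≤d = subst (m ≤_) (p≤q⇒p⊔q≡q 0≤d) m≤0⊔d
... | inj₂ d≤0 = ⊥-elim (<-irrefl refl (<-≤-trans 0<m (subst (m ≤_) (p≥q⇒p⊔q≡p d≤0) m≤0⊔d)))

<⊔-resolveˡ : ∀ {x p q} → x < p ⊔ q → p ≤ x → x < q
<⊔-resolveˡ x<p⊔q p≤x = ≰⇒> λ q≤x → <-irrefl refl (<-≤-trans x<p⊔q (⊔-lub p≤x q≤x))

<⊔-resolveʳ : ∀ {x p q} → x < p ⊔ q → q ≤ x → x < p
<⊔-resolveʳ {p = p} {q} x<p⊔q = <⊔-resolveˡ (subst (_ <_) (⊔-comm p q) x<p⊔q)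

module ByLeftEndpoint {n : ℕ} (I : Fin n → Interval) where

  _≼_ : Fin n → Fin n → Set
  u ≼ v = lo (I u) ≤ lo (I v)

  ≼-total : Total _≼_
  ≼-total u v = ≤-total (lo (I u)) (lo (I v))

module ProperFamily {n : ℕ} (I : Fin n → Interval) (proper : Proper I) where
  open ByLeftEndpoint I

  hi-mono : ∀ {u v} → u ≼ v → hi (I u) ≤ hi (I v)
  hi-mono {u} {v} u≼v = ≮⇒≥ λ hv<hu →
    proper u v ((u≼v , <⇒≤ hv<hu) , λ (_ , hv≡hu) → <-irrefl hv≡hu hv<hu)

  ∈-between : ∀ {u v w x} → u ≼ v → v ≼ w → x ∈I I u → x ∈I I w → x ∈I I v
  ∈-between u≼v v≼w (_ , x≤hu) (lw≤x , _) = ≤-trans v≼w lw≤x , ≤-trans x≤hu (hi-mono u≼v)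

  ∈-cover : ∀ {u v w x y} → u ≼ v → v ≼ w → x ∈I I u → x ∈I I w → y ∈I I v →
            y ∈I I u ⊎ y ∈I I w
  ∈-cover {u} {y = y} u≼v v≼w (_ , x≤hu) (lw≤x , _) (lv≤y , y≤hv) with y ≤? hi (I u)
  ... | yes y≤hu = inj₁ (≤-trans u≼v lv≤y , y≤hu)
  ... | no  y≰hu =
    inj₂ (≤-trans lw≤x (≤-trans x≤hu (<⇒≤ (≰⇒> y≰hu))) , ≤-trans y≤hv (hi-mono v≼w))

  overlapLength-mono : ∀ {u u′ v v′} → u ≼ u′ → v′ ≼ v →
                       overlapLength (I u) (I v) ≤ overlapLength (I u′) (I v′)
  overlapLength-mono u≼u′ v′≼v = +-mono-≤ (hi-mono u≼u′) (neg-antimono-≤ v′≼v)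

  ∣∩∣≡0⊔overlapLength : ∀ {u v} → u ≼ v → ∣ I u ∩ I v ∣ ≡ 0ℚ ⊔ overlapLength (I u) (I v)
  ∣∩∣≡0⊔overlapLength u≼v =
    cong₂ (λ a b → 0ℚ ⊔ (a - b)) (p≤q⇒p⊓q≡p (hi-mono u≼v)) (p≤q⇒p⊔q≡q u≼v)

module _ {G : Graph} {I : Fin (Graph.n G) → Interval} {p : Fin (Graph.n G) → ℚ}
         (rep : IsMPTGRep G I p) where
  open Graph G using (Edge)
  open ByLeftEndpoint I

  private
    p∈I : ∀ u → p u ∈I I u
    p∈I = proj₁ rep

  mptg-edge : ∀ {u v} → u ≢ v → p u ∈I I v → p v ∈I I u → Edge u v
  mptg-edge {u} {v} u≢v pu∈Iv pv∈Iu =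
    Equivalence.from (proj₂ rep u v u≢v) ((p∈I u , pu∈Iv) , (pv∈Iu , p∈I v))

  mptg-edge⁻¹ : ∀ {u v} → Edge u v → p u ∈I I v × p v ∈I I u
  mptg-edge⁻¹ {u} {v} uv with Equivalence.to (proj₂ rep u v (Edge⇒≢ {G} uv)) uv
  ... | (_ , pu∈Iv) , (pv∈Iu , _) = pu∈Iv , pv∈Iu

  properMPTG-bridged : Proper I → Bridged G _≼_
  properMPTG-bridged proper {u} {v} {w} u≼v v≼w uw ¬uv ¬vw =
    [ (λ pv∈Iu → ¬uv (mptg-edge u≢v (∈-between u≼v v≼w (p∈I u) pu∈Iw) pv∈Iu))
    , (λ pv∈Iw → ¬vw (mptg-edge v≢w pv∈Iw (∈-between u≼v v≼w pw∈Iu (p∈I w))))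
    ]′ (∈-cover u≼v v≼w (p∈I u) pu∈Iw (p∈I v))
    where
    open ProperFamily I proper
    pu∈Iw : p u ∈I I w
    pu∈Iw = proj₁ (mptg-edge⁻¹ uw)
    pw∈Iu : p w ∈I I u
    pw∈Iu = proj₂ (mptg-edge⁻¹ uw)
    u≢v : u ≢ v
    u≢v refl = ¬vw uw
    v≢w : v ≢ w
    v≢w refl = ¬uv uw

module ProperMaxTol {G : Graph} {I : Fin (Graph.n G) → Interval} {t : Fin (Graph.n G) → ℚ}
                    (rep : IsMaxTolRep G I t) (proper : Proper I) where
  open Graph G using (Edge)
  open ByLeftEndpoint I
  open ProperFamily I proper
  open ≤-Reasoning

  private
    ℓ : Fin (Graph.n G) → Fin (Graph.n G) → ℚ
    ℓ u v = overlapLength (I u) (I v)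

  tolerated : ∀ {u v} → u ≼ v → Edge u v → t u ⊔ t v ≤ ℓ u v
  tolerated {u} {v} u≼v uv = ≤0⊔⇒≤ (<-≤-trans (proj₁ rep u) (p≤p⊔q (t u) (t v)))
    (subst (t u ⊔ t v ≤_) (∣∩∣≡0⊔overlapLength u≼v)
      (Equivalence.to (proj₂ rep u v (Edge⇒≢ {G} uv)) uv))

  toleratedˡ : ∀ {u v} → u ≼ v → Edge u v → t u ≤ ℓ u v
  toleratedˡ {u} {v} u≼v uv = ≤-trans (p≤p⊔q (t u) (t v)) (tolerated u≼v uv)

  toleratedʳ : ∀ {u v} → u ≼ v → Edge u v → t v ≤ ℓ u v
  toleratedʳ {u} {v} u≼v uv = ≤-trans (p≤q⊔p (t u) (t v)) (tolerated u≼v uv)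

  untolerated : ∀ {u v} → u ≼ v → Apart G u v → ℓ u v < t u ⊔ t v
  untolerated {u} {v} u≼v (u≢v , ¬uv) = ≰⇒> λ tol → ¬uv (Equivalence.from (proj₂ rep u v u≢v)
    (subst (t u ⊔ t v ≤_) (sym (∣∩∣≡0⊔overlapLength u≼v))
      (≤-trans tol (p≤q⊔p 0ℚ (ℓ u v)))))

  crossing-closed : CrossingClosed G _≼_
  crossing-closed {a} {b} {c} {d} a≼b b≼c c≼d ac bd bc = begin-contradiction
    ℓ b c        <⟨ untolerated b≼c bc ⟩
    t b ⊔ t c    ≤⟨ ⊔-lub tb≤ℓbc tc≤ℓbc ⟩
    ℓ b c        ∎
    where
    tb≤ℓbc : t b ≤ ℓ b c
    tb≤ℓbc = ≤-trans (toleratedˡ (≤-trans b≼c c≼d) bd) (overlapLength-mono ≤-refl c≼d)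
    tc≤ℓbc : t c ≤ ℓ b c
    tc≤ℓbc = ≤-trans (toleratedʳ (≤-trans a≼b b≼c) ac) (overlapLength-mono a≼b ≤-refl)

  no-double-gap : NoDoubleGap G _≼_
  -- The two strict inequalities add up to hi c + lo c < hi b + lo b, against b ≼ c.
  no-double-gap {a} {b} {c} {d} a≼b b≼c c≼d ab cd ac ad bd = begin-contradiction
    ℓ c b + ℓ a d  ≡⟨ overlapLength-exchange (I c) (I b) (I a) (I d) ⟩
    ℓ a b + ℓ c d  <⟨ +-mono-< ℓab<ℓbd ℓcd<ℓac ⟩
    ℓ b d + ℓ a c  ≡⟨ overlapLength-exchange (I b) (I d) (I a) (I c) ⟩
    ℓ a d + ℓ b c  ≤⟨ +-monoʳ-≤ (ℓ a d) (overlapLength-mono b≼c b≼c) ⟩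
    ℓ a d + ℓ c b  ≡⟨ +-comm (ℓ a d) (ℓ c b) ⟩
    ℓ c b + ℓ a d  ∎
    where
    a≼c : a ≼ c
    a≼c = ≤-trans a≼b b≼c
    b≼d : b ≼ d
    b≼d = ≤-trans b≼c c≼d
    a≼d : a ≼ d
    a≼d = ≤-trans a≼c c≼d
    ℓab<ℓbd : ℓ a b < ℓ b d
    ℓab<ℓbd = <-≤-trans
      (<⊔-resolveˡ (untolerated a≼b ab)
        (≤-trans (toleratedˡ a≼d ad) (overlapLength-mono ≤-refl b≼d)))
      (toleratedˡ b≼d bd)
    ℓcd<ℓac : ℓ c d < ℓ a c
    ℓcd<ℓac = <-≤-trans
      (<⊔-resolveʳ (untolerated c≼d cd)
        (≤-trans (toleratedʳ a≼d ad) (overlapLength-mono a≼c ≤-refl)))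
      (toleratedʳ a≼c ac)

module _ {G : Graph} {_≼_ : Fin (Graph.n G) → Fin (Graph.n G) → Set} (total : Total _≼_)
         (crossing-closed : CrossingClosed G _≼_) (no-double-gap : NoDoubleGap G _≼_) where
  open Graph G using (n)

  private
    data Position (x y z : Fin n) : Set where
      before : z ≼ x → Position x y z
      inside : x ≼ z → z ≼ y → Position x y z
      after  : y ≼ z → Position x y z

    position : ∀ x y z → Position x y z
    position x y z with total z x
    ... | inj₁ z≼x = before z≼x
    ... | inj₂ x≼z with total z y
    ...   | inj₁ z≼y = inside x≼z z≼y
    ...   | inj₂ y≼z = after y≼z

    isInside : ∀ {x y z} → Position x y z → Bool
    isInside (inside _ _) = true
    isInside _            = false

    two-of-three-equal : (a b c : Bool) → a ≡ b ⊎ a ≡ c ⊎ b ≡ c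
    two-of-three-equal false false _     = inj₁ refl
    two-of-three-equal true  true  _     = inj₁ refl
    two-of-three-equal false true  false = inj₂ (inj₁ refl)
    two-of-three-equal true  false true  = inj₂ (inj₁ refl)
    two-of-three-equal false true  true  = inj₂ (inj₂ refl)
    two-of-three-equal true  false false = inj₂ (inj₂ refl)

  module _ {x y : Fin n} (x≼y : x ≼ y) (xy : Apart G x y) where

    private
      clash≼ : ∀ {z z′} → CommonNeighbour G x y z → CommonNeighbour G x y z′ → Apart G z z′ →
               z ≼ z′ → (P : Position x y z) (P′ : Position x y z′) → isInside P ≡ isInside P′ → ⊥
      clash≼ (xz , yz) (_ , yz′) zz′ z≼z′ (before z≼x) (before z′≼x) _ =
        no-double-gap z≼z′ z′≼x x≼y zz′ xy (Edge-sym {G} xz) (Edge-sym {G} yz) (Edge-sym {G} yz′)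
      clash≼ (_ , yz) (xz′ , _) _ _ (before z≼x) (after y≼z′) _ =
        crossing-closed z≼x x≼y y≼z′ (Edge-sym {G} yz) xz′ xy
      clash≼ (_ , yz) (xz′ , _) zz′ z≼z′ (inside x≼z _) (inside _ z′≼y) _ =
        crossing-closed x≼z z≼z′ z′≼y xz′ (Edge-sym {G} yz) zz′
      clash≼ (xz , _) (_ , yz′) _ _ (after y≼z) (before z′≼x) _ =
        crossing-closed z′≼x x≼y y≼z (Edge-sym {G} yz′) xz xy
      clash≼ (xz , _) (xz′ , yz′) zz′ z≼z′ (after y≼z) (after _) _ =
        no-double-gap x≼y y≼z z≼z′ xy zz′ xz xz′ yz′
      clash≼ _ _ _ _ (before _)   (inside _ _) ()
      clash≼ _ _ _ _ (inside _ _) (before _)   ()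
      clash≼ _ _ _ _ (inside _ _) (after _)    ()
      clash≼ _ _ _ _ (after _)    (inside _ _) ()

      clash : ∀ {z z′} → CommonNeighbour G x y z → CommonNeighbour G x y z′ → Apart G z z′ →
              isInside (position x y z) ≡ isInside (position x y z′) → ⊥
      clash {z} {z′} Nz Nz′ zz′ same with total z z′
      ... | inj₁ z≼z′ = clash≼ Nz Nz′ zz′ z≼z′ _ _ same
      ... | inj₂ z′≼z = clash≼ Nz′ Nz (Apart-sym {G} zz′) z′≼z _ _ (sym same)

    no-ordered-K₂,₃ : ∀ {z₁ z₂ z₃} → CommonNeighbour G x y z₁ → CommonNeighbour G x y z₂ →
                      CommonNeighbour G x y z₃ → Apart G z₁ z₂ → Apart G z₁ z₃ → Apart G z₂ z₃ → ⊥
    no-ordered-K₂,₃ {z₁} {z₂} {z₃} N₁ N₂ N₃ z₁z₂ z₁z₃ z₂z₃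
      with two-of-three-equal (isInside (position x y z₁)) (isInside (position x y z₂))
                              (isInside (position x y z₃))
    ... | inj₁ same        = clash N₁ N₂ z₁z₂ same
    ... | inj₂ (inj₁ same) = clash N₁ N₃ z₁z₃ same
    ... | inj₂ (inj₂ same) = clash N₂ N₃ z₂z₃ same

  no-induced-K₂,₃ : ∀ {x y z₁ z₂ z₃} → Apart G x y →
                    CommonNeighbour G x y z₁ → CommonNeighbour G x y z₂ → CommonNeighbour G x y z₃ →
                    Apart G z₁ z₂ → Apart G z₁ z₃ → Apart G z₂ z₃ → ⊥
  no-induced-K₂,₃ {x} {y} xy N₁ N₂ N₃ with total x y
  ... | inj₁ x≼y = no-ordered-K₂,₃ x≼y xy N₁ N₂ N₃
  ... | inj₂ y≼x = no-ordered-K₂,₃ y≼x (Apart-sym {G} xy) (swap N₁) (swap N₂) (swap N₃)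

_∈I?_ : (x : ℚ) (J : Interval) → Dec (x ∈I J)
x ∈I? J = (lo J ≤? x) ×-dec (x ≤? hi J)

_⊂I?_ : (J K : Interval) → Dec (J ⊂I K)
J ⊂I? K = ((lo K ≤? lo J) ×-dec (hi J ≤? hi K)) ×-dec ¬? ((lo J ≟ lo K) ×-dec (hi J ≟ hi K))

_⇔?_ : ∀ {A B : Set} → Dec A → Dec B → Dec (A ⇔ B)
a? ⇔? b? = map′ (λ (f , g) → mk⇔ f g) (λ e → Equivalence.to e , Equivalence.from e)
                ((a? →-dec b?) ×-dec (b? →-dec a?))

proper? : ∀ {n} (I : Fin n → Interval) → Dec (Proper I)
proper? I = Fin.all? λ u → Fin.all? λ v → ¬? (I v ⊂I? I u)

module _ (G : Graph) where
  open Graph G using (n; adj)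

  private
    ∀-distinct? : {P : Fin n → Fin n → Set} → (∀ u v → Dec (P u v)) →
                  Dec (∀ u v → u ≢ v → P u v)
    ∀-distinct? P? = Fin.all? λ u → Fin.all? λ v → ¬? (u Fin.≟ v) →-dec P? u v

    edge? : ∀ u v → Dec (Graph.Edge G u v)
    edge? u v = adj u v Bool.≟ true

  isMaxTolRep? : ∀ I t → Dec (IsMaxTolRep G I t)
  isMaxTolRep? I t = Fin.all? (λ u → 0ℚ <? t u) ×-dec
    ∀-distinct? λ u v → edge? u v ⇔? (t u ⊔ t v ≤? ∣ I u ∩ I v ∣)

  isMPTGRep? : ∀ I p → Dec (IsMPTGRep G I p)
  isMPTGRep? I p = Fin.all? (λ u → p u ∈I? I u) ×-dec
    ∀-distinct? λ u v → edge? u v ⇔?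
      ((p u ∈I? I u ×-dec p u ∈I? I v) ×-dec (p v ∈I? I u ×-dec p v ∈I? I v))

graph : (n : ℕ) (adj : Fin n → Fin n → Bool) →
        {True (Fin.all? λ u → Fin.all? λ v → adj u v Bool.≟ adj v u)} →
        {True (Fin.all? λ u → adj u u Bool.≟ false)} → Graph
graph n adj {sym?} {irrefl?} = record
  { n = n ; adj = adj ; sym = toWitness sym? ; irref = toWitness irrefl? }

C₅ : Graph
C₅ = graph 5 λ i j → let d = ∣ toℕ i - toℕ j ∣ in (d ≡ᵇ 1) ∨ (d ≡ᵇ 4)

K₂,₃ : Graph
K₂,₃ = graph 5 λ i j → (toℕ i <ᵇ 2) xor (toℕ j <ᵇ 2)

private
  C₅-unbridgeable-if-0≼2 : ∀ {_≼_} → Total _≼_ → Bridged C₅ _≼_ → 0F ≼ 2F → ⊥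
  C₅-unbridgeable-if-0≼2 {_≼_} total bridged 0≼2 = bridged 3≼0 0≼2 refl (λ ()) (λ ())
    where
    forced : ∀ {u v} → ¬ u ≼ v → v ≼ u
    forced {u} {v} u⋠v = [ (λ u≼v → ⊥-elim (u⋠v u≼v)) , id ]′ (total u v)
    4≼2 : 4F ≼ 2F
    4≼2 = forced λ 2≼4 → bridged 0≼2 2≼4 refl (λ ()) (λ ())
    4≼1 : 4F ≼ 1F
    4≼1 = forced λ 1≼4 → bridged 1≼4 4≼2 refl (λ ()) (λ ())
    3≼1 : 3F ≼ 1F
    3≼1 = forced λ 1≼3 → bridged 4≼1 1≼3 refl (λ ()) (λ ())
    3≼0 : 3F ≼ 0F
    3≼0 = forced λ 0≼3 → bridged 0≼3 3≼1 refl (λ ()) (λ ())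

C₅-unbridgeable : ∀ {_≼_} → Total _≼_ → ¬ Bridged C₅ _≼_
C₅-unbridgeable {_≼_} total bridged with total 0F 2F
... | inj₁ 0≼2 = C₅-unbridgeable-if-0≼2 total bridged 0≼2
... | inj₂ 2≼0 = C₅-unbridgeable-if-0≼2 (flip total) (Bridged-flip {C₅} {_≼_} bridged) 2≼0

fromℕ : ℕ → ℚ
fromℕ k = + k / 1

interval : (a b : ℕ) → {True (fromℕ a ≤? fromℕ b)} → Interval
interval a b {a≤b} = [ fromℕ a , fromℕ b ]⟨ toWitness a≤b ⟩

C₅-properMaxTol : IsProperMaxTol C₅
C₅-properMaxTol = I , t , from-yes (isMaxTolRep? C₅ I t) , from-yes (proper? I)
  where
  I : Fin 5 → Interval
  I 0F = interval 0 11
  I 1F = interval 9 18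
  I 2F = interval 6 17
  I 3F = interval 3 15
  I 4F = interval 2 12
  t : Fin 5 → ℚ
  t 0F = fromℕ 2
  t 1F = fromℕ 2
  t 2F = fromℕ 7
  t 3F = fromℕ 9
  t 4F = fromℕ 6

K₂,₃-properMPTG : IsProperMPTG K₂,₃
K₂,₃-properMPTG = I , p , from-yes (isMPTGRep? K₂,₃ I p) , from-yes (proper? I)
  where
  I : Fin 5 → Interval
  I 0F = interval 1 12
  I 1F = interval 3 13
  I 2F = interval 4 14
  I 3F = interval 5 15
  I 4F = interval 7 20
  p : Fin 5 → ℚ
  p 0F = fromℕ 12
  p 1F = fromℕ 13
  p 2F = fromℕ 4
  p 3F = fromℕ 5
  p 4F = fromℕ 9

C₅-not-properMPTG : ¬ IsProperMPTG C₅
C₅-not-properMPTG (I , p , rep , proper) =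
  C₅-unbridgeable (ByLeftEndpoint.≼-total I) (properMPTG-bridged {C₅} {I} {p} rep proper)

K₂,₃-not-properMaxTol : ¬ IsProperMaxTol K₂,₃
K₂,₃-not-properMaxTol (I , t , rep , proper) =
  no-induced-K₂,₃ {K₂,₃} (ByLeftEndpoint.≼-total I) crossing-closed no-double-gap
    {0F} {1F} {2F} {3F} {4F}
    ((λ ()) , (λ ())) (refl , refl) (refl , refl) (refl , refl)
    ((λ ()) , (λ ())) ((λ ()) , (λ ())) ((λ ()) , (λ ()))
  where open ProperMaxTol {K₂,₃} {I} {t} rep proper

proposition3p22 : (∃ λ (G : Graph) → IsProperMaxTol G × ¬ IsProperMPTG G)
                  × (∃ λ (G : Graph) → IsProperMPTG G × ¬ IsProperMaxTol G)
proposition3p22 =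
  (C₅ , C₅-properMaxTol , C₅-not-properMPTG) , (K₂,₃ , K₂,₃-properMPTG , K₂,₃-not-properMaxTol)
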